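{- Let $G$ be a graph with edge set $E(G)=\{e_1,\ldots,e_m\}$ and let $Q=(q(i,j))$ be the $m\times m$ cost matrix of the QMST on $G$. If $\pi$ is a permutation of $\{1,\ldots,m\}$ such that $\pi(Q)$ is doubly graded, then the $\pi$-critical spanning tree of $G$ is an optimal solution of the QMST with cost matrix $Q$.
   Context: QMST: given costs $c_{e_i}$ and $q(i,j)=q(e_i,e_j)$ for $i\neq j$, minimize $z(T)=\sum_{e\in T}\sum_{f\in T,f\neq e}q(e,f)+\sum_{e\in T}c_e$ over all spanning trees $T$ of $G$; its cost matrix $Q$ has $(i,j)$-entry $q(i,j)$ for $i\neq j$ and $c_{e_i}$ for $i=j$. An $m\times m$ matrix $Q$ is row graded if $q(i,1)\leq\cdots\leq q(i,m)$ for all $i$, and doubly graded if both $Q$ and its transpose $Q^T$ are row graded. For a permutation $\pi$ of $\{1,\ldots,m\}$, $\pi(Q)$ is the matrix with $(i,j)$-entry $q(\pi^{ -1}(i),\pi^{ -1}(j))$. The $\pi$-critical spanning tree is the spanning tree $T=\{e_{i_1},\ldots,e_{i_{n-1}}\}$ for which $\{\pi(i_1),\ldots,\pi(i_{n-1})\}$ is lexicographically smallest (comparing sets as increasingly sorted sequences) among all spanning trees of $G$.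
   Formalization: The cost matrix Q, that is the costs $c_e$ and $q(i,j)$, has rational entries. -}

module Defs where

open import Data.Nat as ℕ using (ℕ; zero; suc)
open import Data.Fin as Fin using (Fin; zero; suc; toℕ)
open import Data.Fin.Subset using (Subset; _∈_; _∉_)
open import Data.Fin.Subset.Properties using (_∈?_)
open import Data.Fin.Permutation using (Permutation′; _⟨$⟩ʳ_; _⟨$⟩ˡ_)
open import Data.Bool using (Bool; true; false; if_then_else_)
open import Data.List using (List; []; _∷_; filterᵇ; map; length)
open import Data.List.Base using (allFin)
open import Data.Product using (_×_; _,_; proj₁; proj₂)
open import Data.Sum using (_⊎_)
open import Data.Unit using (⊤)
open import Data.Empty using (⊥)
open import Relation.Binary.PropositionalEquality using (_≡_; _≢_)
open import Relation.Nullary using (¬_)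
open import Relation.Nullary.Decidable using (⌊_⌋)
open import Data.Rational as ℚ using (ℚ; 0ℚ; _+_; _≤_)

record Graph (n m : ℕ) : Set where
  field
    ends : Fin m → Fin n × Fin n

open Graph public

EdgeSet : ℕ → Set
EdgeSet m = Subset m

Joins : ∀ {n m} → Graph n m → Fin m → Fin n → Fin n → Set
Joins G e u w = (proj₁ (ends G e) ≡ u × proj₂ (ends G e) ≡ w)
              ⊎ (proj₁ (ends G e) ≡ w × proj₂ (ends G e) ≡ u)

data Walk {n m} (G : Graph n m) (Allowed : Fin m → Set) : Fin n → Fin n → Set where
  here : ∀ {u} → Walk G Allowed u u
  step : ∀ {u w v} (e : Fin m) → Allowed e → Joins G e u w →
         Walk G Allowed w v → Walk G Allowed u v

Connected : ∀ {n m} → Graph n m → EdgeSet m → Set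
Connected G S = ∀ u v → Walk G (λ e → e ∈ S) u v

-- The subgraph (V(G), S) is acyclic: no edge of S lies on a cycle of S,
-- i.e. for every e ∈ S the endpoints of e are not joined by a walk in S ∖ {e}.
-- (A loop edge is a cycle by itself and is excluded since `here` joins u to u.)
Acyclic : ∀ {n m} → Graph n m → EdgeSet m → Set
Acyclic G S = ∀ e → e ∈ S →
  ¬ Walk G (λ f → f ∈ S × f ≢ e) (proj₁ (ends G e)) (proj₂ (ends G e))

SpanningTree : ∀ {n m} → Graph n m → EdgeSet m → Set
SpanningTree G T = Connected G T × Acyclic G T

sumFin : ∀ m → (Fin m → ℚ) → ℚ
sumFin zero    f = 0ℚ
sumFin (suc m) f = f zero + sumFin m (λ i → f (suc i))

sumOver : ∀ {m} → Subset m → (Fin m → ℚ) → ℚ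
sumOver {m} S f = sumFin m (λ i → if ⌊ i ∈? S ⌋ then f i else 0ℚ)

-- QMST.  Cost matrix Q : Fin m → Fin m → ℚ, with Q i i = c_{e_i}.

CostMatrix : ℕ → Set
CostMatrix m = Fin m → Fin m → ℚ

qmstCost : ∀ {m} → CostMatrix m → EdgeSet m → ℚ
qmstCost Q T =
  sumOver T (λ e → sumOver T (λ f → if ⌊ e Fin.≟ f ⌋ then 0ℚ else Q e f))
  + sumOver T (λ e → Q e e)

Optimal : ∀ {n m} → Graph n m → CostMatrix m → EdgeSet m → Set
Optimal G Q T = SpanningTree G T × (∀ T′ → SpanningTree G T′ → qmstCost Q T ≤ qmstCost Q T′)

RowGraded : ∀ {m} → CostMatrix m → Set
RowGraded {m} M = ∀ (i j k : Fin m) → j Fin.≤ k → M i j ≤ M i k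

transpose : ∀ {m} → CostMatrix m → CostMatrix m
transpose M i j = M j i

DoublyGraded : ∀ {m} → CostMatrix m → Set
DoublyGraded M = RowGraded M × RowGraded (transpose M)

permute : ∀ {m} → Permutation′ m → CostMatrix m → CostMatrix m
permute π Q i j = Q (π ⟨$⟩ˡ i) (π ⟨$⟩ˡ j)

-- Increasingly sorted list of {π(i) | e_i ∈ T}: enumerate j = 0..m-1
-- in increasing order, keeping j iff π⁻¹(j) ∈ T.
sortedImage : ∀ {m} → Permutation′ m → EdgeSet m → List ℕ
sortedImage {m} π T =
  map toℕ (filterᵇ (λ j → ⌊ (π ⟨$⟩ˡ j) ∈? T ⌋) (allFin m))

LexLeq : List ℕ → List ℕ → Set
LexLeq []       _        = ⊤
LexLeq (x ∷ xs) []       = ⊥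
LexLeq (x ∷ xs) (y ∷ ys) = x ℕ.< y ⊎ (x ≡ y × LexLeq xs ys)

Critical : ∀ {n m} → Graph n m → Permutation′ m → EdgeSet m → Set
Critical G π T = SpanningTree G T ×
  (∀ T′ → SpanningTree G T′ → LexLeq (sortedImage π T) (sortedImage π T′))

module Submission where

-- Since π(Q) grows along rows and columns, exchanging an edge f of a tree for
-- an edge e ranked before it (π e < π f) can only lower every term of the cost.
-- The π-critical tree T has the cycle property: the ends of every edge f ∉ T are
-- joined in T by edges ranked before f, for otherwise some T-edge ranked after f
-- separates them and exchanging it for f gives a lexicographically smaller tree.
-- Given another spanning tree S with an edge f ∉ T, removing f cuts S in two;
-- one of those T-edges e crosses the cut, so S - f + e is a spanning tree, no
-- more expensive, with one more edge in common with T. Induction on |S ∖ T|.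
-- Reachability is not decided, so the graph arguments run in the double-negation
-- monad; this is harmless because ≤ on ℚ is decidable.

open import Defs
open import Level using (0ℓ)
open import Data.Nat as ℕ using (ℕ; zero; suc)
import Data.Nat.Properties as ℕP
open import Data.Fin as Fin using (Fin; zero; suc; toℕ)
open import Data.Fin.Properties using (toℕ-injective) renaming (≤-refl to ≤ᶠ-refl)
open import Data.Fin.Subset using (Subset)
open import Data.Fin.Subset.Properties using (_∈?_)
open import Data.Fin.Permutation using (Permutation′; _⟨$⟩ʳ_; _⟨$⟩ˡ_; inverseˡ; inverseʳ)
import Data.Fin.Permutation as Perm
import Data.Fin.Permutation.Components as PC
open import Data.Bool using (Bool; true; false; if_then_else_)
import Data.Bool.Properties as BoolP
open import Data.Vec using (_∷_; lookup; tabulate)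
open import Data.Vec.Properties using ([]=⇒lookup; lookup⇒[]=; lookup∘tabulate)
open import Data.List using (List; []; _∷_; allFin; filterᵇ; map)
open import Data.List.Membership.Propositional using () renaming (_∈_ to _∈ˡ_)
open import Data.List.Membership.Propositional.Properties using (∈-allFin)
open import Data.List.Relation.Unary.Any using (here; there)
import Data.List.Relation.Unary.All as All
open import Data.List.Relation.Unary.AllPairs using (AllPairs; _∷_)
open import Data.List.Relation.Unary.AllPairs.Properties using (tabulate⁺-<)
open import Data.Product using (∃-syntax; _×_; _,_; proj₁; proj₂)
open import Data.Sum using (_⊎_; inj₁; inj₂)
open import Data.Rational using (ℚ; 0ℚ; _+_; _≤_)
import Data.Rational.Properties as ℚP
import Algebra.Properties.CommutativeMonoid.Sum as CommutativeMonoidSum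
open import Effect.Monad using (RawMonad)
open import Function using (_∘_; id)
open import Function.Bundles using (Injection; mk⇔)
open import Function.Properties.Inverse using (↔⇒↣)
open import Relation.Binary.PropositionalEquality
  using (_≡_; _≢_; refl; sym; trans; cong; cong₂; subst₂; module ≡-Reasoning)
open import Relation.Nullary using (¬_; yes; no)
open import Relation.Nullary.Decidable using (⌊_⌋; ¬¬-excluded-middle; decidable-stable)
open import Relation.Nullary.Negation using (¬¬-Monad; contradiction)

open RawMonad (¬¬-Monad {0ℓ})

transpose-cases : ∀ {m} (a b k : Fin m) →
  (k ≡ a × PC.transpose a b k ≡ b) ⊎
  (k ≢ a × k ≡ b × PC.transpose a b k ≡ a) ⊎
  (k ≢ a × k ≢ b × PC.transpose a b k ≡ k)
transpose-cases a b k with k Fin.≟ a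
... | yes k≡a = inj₁ (k≡a , refl)
... | no k≢a with k Fin.≟ b
...   | yes k≡b = inj₂ (inj₁ (k≢a , k≡b , refl))
...   | no k≢b  = inj₂ (inj₂ (k≢a , k≢b , refl))

transpose-matchˡ : ∀ {m} (a b : Fin m) → PC.transpose a b a ≡ b
transpose-matchˡ a b with transpose-cases a b a
... | inj₁ (_ , σa≡b)             = σa≡b
... | inj₂ (inj₁ (a≢a , _))       = contradiction refl a≢a
... | inj₂ (inj₂ (a≢a , _))       = contradiction refl a≢a

infixl 6 _∖_

_∖_ : ∀ {m} → (Fin m → Set) → Fin m → Fin m → Set
(A ∖ x) e = A e × e ≢ x

module Trees {n m : ℕ} (G : Graph n m) where

  infixr 5 _++ʷ_

  end₁ end₂ : Fin m → Fin n
  end₁ e = proj₁ (ends G e)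
  end₂ e = proj₂ (ends G e)

  IsConnected IsAcyclic IsTree : (Fin m → Set) → Set
  IsConnected A = ∀ u v → Walk G A u v
  IsAcyclic A = ∀ e → A e → ¬ Walk G (A ∖ e) (end₁ e) (end₂ e)
  IsTree A = IsConnected A × IsAcyclic A

  walk-map : ∀ {A B} → (∀ {e} → A e → B e) → ∀ {u v} → Walk G A u v → Walk G B u v
  walk-map A⊆B here = here
  walk-map A⊆B (step e a j w) = step e (A⊆B a) j (walk-map A⊆B w)

  _++ʷ_ : ∀ {A u v w} → Walk G A u v → Walk G A v w → Walk G A u w
  here ++ʷ q = q
  step e a j p ++ʷ q = step e a j (p ++ʷ q)

  joins-sym : ∀ {e u w} → Joins G e u w → Joins G e w u
  joins-sym (inj₁ (a , b)) = inj₂ (a , b)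
  joins-sym (inj₂ (a , b)) = inj₁ (a , b)

  reverseʷ : ∀ {A u v} → Walk G A u v → Walk G A v u
  reverseʷ here = here
  reverseʷ (step e a j w) = reverseʷ w ++ʷ step e a (joins-sym j) here

  edge-walk : ∀ {A e} → A e → Walk G A (end₁ e) (end₂ e)
  edge-walk {e = e} a = step e a (inj₁ (refl , refl)) here

  joins-walk : ∀ {A e x y} → Joins G e x y → Walk G A (end₁ e) (end₂ e) → Walk G A x y
  joins-walk (inj₁ (refl , refl)) w = w
  joins-walk (inj₂ (refl , refl)) w = reverseʷ w

  IsAcyclic-⊆ : ∀ {A B} → (∀ {e} → A e → B e) → IsAcyclic B → IsAcyclic A
  IsAcyclic-⊆ A⊆B acyclic e a w = acyclic e (A⊆B a) (walk-map (λ (a , e≢) → A⊆B a , e≢) w)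

  IsTree-resp : ∀ {A B} → (∀ {e} → A e → B e) → (∀ {e} → B e → A e) → IsTree A → IsTree B
  IsTree-resp A⊆B B⊆A (connected , acyclic) =
    (λ u v → walk-map A⊆B (connected u v)) , IsAcyclic-⊆ B⊆A acyclic

  IsEnd : Fin m → Fin n → Set
  IsEnd x a = a ≡ end₁ x ⊎ a ≡ end₂ x

  data Split (A : Fin m → Set) (x : Fin m) (u v : Fin n) : Set where
    avoiding : Walk G (A ∖ x) u v → Split A x u v
    through  : ∀ {a b} → IsEnd x a → IsEnd x b →
               Walk G (A ∖ x) u a → Walk G (A ∖ x) b v → Split A x u v

  joins-start : ∀ {e u w} → Joins G e u w → IsEnd e u
  joins-start (inj₁ (p , _)) = inj₁ (sym p)
  joins-start (inj₂ (_ , q)) = inj₂ (sym q)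

  joins-stop : ∀ {e u w} → Joins G e u w → IsEnd e w
  joins-stop j = joins-start (joins-sym j)

  split : ∀ {A u v} x → Walk G A u v → Split A x u v
  split x here = avoiding here
  split x (step e a j w) with e Fin.≟ x | split x w
  ... | yes refl | avoiding w′         = through (joins-start j) (joins-stop j) here w′
  ... | yes refl | through _ eb _ w₂   = through (joins-start j) eb here w₂
  ... | no e≢x   | avoiding w′         = avoiding (step e (a , e≢x) j w′)
  ... | no e≢x   | through ea eb w₁ w₂ = through ea eb (step e (a , e≢x) j w₁) w₂

  ends-equal : ∀ {B x a b} → IsEnd x a → IsEnd x b → Walk G B a b →
               ¬ Walk G B (end₁ x) (end₂ x) → a ≡ b
  ends-equal (inj₁ refl) (inj₁ refl) _ _  = refl
  ends-equal (inj₂ refl) (inj₂ refl) _ _  = refl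
  ends-equal (inj₁ refl) (inj₂ refl) w ¬w = contradiction w ¬w
  ends-equal (inj₂ refl) (inj₁ refl) w ¬w = contradiction (reverseʷ w) ¬w

  -- Cut w at its first use of x: joined through d, the two pieces link the ends
  -- of x they reach, which must then coincide, so the pieces glue up without x.
  reroute : ∀ {A D x u v} → (∀ {e} → (A ∖ x) e → D e) → ¬ Walk G D (end₁ x) (end₂ x) →
            Walk G D u v → Walk G A u v → Walk G (A ∖ x) u v
  reroute {x = x} A∖x⊆D ¬d d w with split x w
  ... | avoiding w′ = w′
  ... | through ea eb w₁ w₂
    with ends-equal ea eb (reverseʷ (walk-map A∖x⊆D w₁) ++ʷ d ++ʷ reverseʷ (walk-map A∖x⊆D w₂)) ¬d
  ...   | refl = w₁ ++ʷ w₂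

  exchange : ∀ {S out inn} → IsTree S → ¬ Walk G (S ∖ out) (end₁ inn) (end₂ inn) →
             IsTree (λ e → e ≡ inn ⊎ (S ∖ out) e)
  exchange {S} {out} {inn} (connected , acyclic) ¬w =
    (λ u v → to-end₁ u ++ʷ reverseʷ (to-end₁ v)) , acyclic′
    where
      S′ : Fin m → Set
      S′ e = e ≡ inn ⊎ (S ∖ out) e

      kept : ∀ {e} → (S ∖ out) e → S′ e
      kept = inj₂

      side : ∀ w → Walk G (S ∖ out) w (end₁ out) ⊎ Walk G (S ∖ out) w (end₂ out)
      side w with split out (connected w (end₁ out))
      ... | avoiding w′              = inj₁ w′
      ... | through (inj₁ refl) _ w₁ _ = inj₁ w₁
      ... | through (inj₂ refl) _ w₁ _ = inj₂ w₁

      across : Walk G S′ (end₂ out) (end₁ out)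
      across with side (end₁ inn) | side (end₂ inn)
      ... | inj₁ p | inj₁ q = contradiction (p ++ʷ reverseʷ q) ¬w
      ... | inj₂ p | inj₂ q = contradiction (p ++ʷ reverseʷ q) ¬w
      ... | inj₁ p | inj₂ q =
        walk-map kept (reverseʷ q) ++ʷ reverseʷ (edge-walk (inj₁ refl)) ++ʷ walk-map kept p
      ... | inj₂ p | inj₁ q =
        walk-map kept (reverseʷ p) ++ʷ edge-walk (inj₁ refl) ++ʷ walk-map kept q

      to-end₁ : ∀ w → Walk G S′ w (end₁ out)
      to-end₁ w with side w
      ... | inj₁ p = walk-map kept p
      ... | inj₂ p = walk-map kept p ++ʷ across

      old : ∀ {e} → (S′ ∖ inn) e → (S ∖ out) e
      old (inj₁ refl , e≢inn) = contradiction refl e≢inn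
      old (inj₂ kept , _)     = kept

      -- A cycle of S′ through g ∈ S can be rerouted around inn into a cycle of S.
      acyclic′ : IsAcyclic S′
      acyclic′ g (inj₁ refl) w = ¬w (walk-map old w)
      acyclic′ g (inj₂ (Sg , g≢out)) w =
        acyclic g Sg (walk-map (λ ((S′e , e≢g) , e≢inn) → proj₁ (old (S′e , e≢inn)) , e≢g)
          (reroute (λ ((S′e , _) , e≢inn) → old (S′e , e≢inn)) ¬w (edge-walk (Sg , g≢out)) w))

  connected⊆acyclic⇒¬¬⊇ : ∀ {A B} → IsConnected A → IsAcyclic B → (∀ {e} → A e → B e) →
                            ∀ {e} → B e → ¬ ¬ A e
  connected⊆acyclic⇒¬¬⊇ connected acyclic A⊆B {e} Be ¬Ae =
    acyclic e Be (walk-map (λ Ag → A⊆B Ag , λ { refl → ¬Ae Ag }) (connected (end₁ e) (end₂ e)))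

  crossing-edge : ∀ {A} (C : Fin n → Set) {u v} → Walk G A u v → C u → ¬ C v →
                  ¬ ¬ (∃[ e ] ∃[ x ] ∃[ y ] A e × Joins G e x y × C x × ¬ C y)
  crossing-edge C here Cu ¬Cv = contradiction Cu ¬Cv
  crossing-edge C (step {w = w} e a j rest) Cu ¬Cv = do
    no ¬Cw ← ¬¬-excluded-middle {A = C w}
      where yes Cw → crossing-edge C rest Cw ¬Cv
    pure (e , _ , w , a , j , Cu , ¬Cw)

  -- Removing the edges of F outside B one at a time: the first removal that
  -- disconnects u from v exists, since removing them all would leave a walk in B.
  cut-edge : ∀ {B F u v} → IsAcyclic F → Walk G F u v → ¬ Walk G B u v →
             ¬ ¬ (∃[ e ] F e × ¬ B e × ¬ Walk G (F ∖ e) u v)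
  cut-edge {B} {u = u} {v} acyclic w ¬w = remove (allFin m) (λ {g} _ → inj₂ (∈-allFin g)) acyclic w
    where
      Covered : (Fin m → Set) → List (Fin m) → Set
      Covered F es = ∀ {g} → F g → B g ⊎ g ∈ˡ es

      narrow : ∀ {F e es} → Covered F (e ∷ es) → (∀ {g} → F g → g ≡ e → B g) → Covered F es
      narrow cover at-e Fg with cover Fg
      ... | inj₁ Bg            = inj₁ Bg
      ... | inj₂ (here g≡e)    = inj₁ (at-e Fg g≡e)
      ... | inj₂ (there g∈es)  = inj₂ g∈es

      remove : ∀ es {F} → Covered F es → IsAcyclic F → Walk G F u v →
               ¬ ¬ (∃[ e ] F e × ¬ B e × ¬ Walk G (F ∖ e) u v)
      remove [] cover _ w = contradiction (walk-map (λ Fg → in-B (cover Fg)) w) ¬w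
        where
          in-B : ∀ {g} → B g ⊎ g ∈ˡ [] → B g
          in-B (inj₁ Bg) = Bg
      remove (e ∷ es) {F} cover acyclic w = do
        yes Fe ← ¬¬-excluded-middle {A = F e}
          where no ¬Fe → remove es (narrow {F} cover λ { Fg refl → contradiction Fg ¬Fe }) acyclic w
        no ¬Be ← ¬¬-excluded-middle {A = B e}
          where yes Be → remove es (narrow {F} cover λ { _ refl → Be }) acyclic w
        yes w∖e ← ¬¬-excluded-middle {A = Walk G (F ∖ e) u v}
          where no ¬w∖e → pure (e , Fe , ¬Be , ¬w∖e)
        (e′ , (Fe′ , _) , ¬Be′ , ¬w∖e∖e′) ← remove es {F ∖ e} cover∖e (IsAcyclic-⊆ proj₁ acyclic) w∖e
        pure (e′ , Fe′ , ¬Be′ , λ w∖e′ → ¬w∖e∖e′ (walk-map swap∖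
          (reroute {A = F ∖ e′} (λ ((Fg , _) , g≢e) → Fg , g≢e) (acyclic e Fe) w∖e w∖e′)))
        where
          cover∖e : Covered (F ∖ e) es
          cover∖e = narrow {F ∖ e} (λ (Fg , _) → cover Fg) λ (_ , g≢e) g≡e → contradiction g≡e g≢e

          swap∖ : ∀ {e′ g} → ((F ∖ e′) ∖ e) g → ((F ∖ e) ∖ e′) g
          swap∖ ((Fg , g≢e′) , g≢e) = (Fg , g≢e) , g≢e′

  -- Edge sets are handled through their characteristic functions, so that
  -- exchanging out for inn is precomposition with the transposition (inn out).
  Edges : (Fin m → Bool) → Fin m → Set
  Edges b e = b e ≡ true

  SpanningTree⇒IsTree : ∀ {S} → SpanningTree G S → IsTree (Edges (lookup S))
  SpanningTree⇒IsTree = IsTree-resp []=⇒lookup (lookup⇒[]= _ _)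

  IsTree⇒SpanningTree : ∀ {S} → IsTree (Edges (lookup S)) → SpanningTree G S
  IsTree⇒SpanningTree = IsTree-resp (lookup⇒[]= _ _) []=⇒lookup

  exchangeᵇ : ∀ {b inn out} → IsTree (Edges b) → b out ≡ true → b inn ≡ false →
              ¬ Walk G (Edges b ∖ out) (end₁ inn) (end₂ inn) →
              IsTree (Edges (b ∘ PC.transpose inn out))
  exchangeᵇ {b} {inn} {out} tree b-out b-inn ¬w = IsTree-resp into from (exchange tree ¬w)
    where
      into : ∀ {e} → e ≡ inn ⊎ (Edges b ∖ out) e → b (PC.transpose inn out e) ≡ true
      into {e} e∈ with transpose-cases inn out e | e∈
      ... | inj₁ (_ , σe≡out)                 | _                  = trans (cong b σe≡out) b-out
      ... | inj₂ (inj₁ (e≢inn , _ , _))       | inj₁ e≡inn         = contradiction e≡inn e≢inn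
      ... | inj₂ (inj₁ (_ , e≡out , _))       | inj₂ (_ , e≢out)   = contradiction e≡out e≢out
      ... | inj₂ (inj₂ (e≢inn , _ , _))       | inj₁ e≡inn         = contradiction e≡inn e≢inn
      ... | inj₂ (inj₂ (_ , _ , σe≡e))        | inj₂ (b-e , _)     = trans (cong b σe≡e) b-e

      from : ∀ {e} → b (PC.transpose inn out e) ≡ true → e ≡ inn ⊎ (Edges b ∖ out) e
      from {e} b-σe with transpose-cases inn out e
      ... | inj₁ (e≡inn , _)               = inj₁ e≡inn
      ... | inj₂ (inj₁ (_ , _ , σe≡inn))   =
        contradiction (trans (sym b-σe) (trans (cong b σe≡inn) b-inn)) λ ()
      ... | inj₂ (inj₂ (_ , e≢out , σe≡e)) = inj₂ (trans (sym (cong b σe≡e)) b-σe , e≢out)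

sumFin-cong : ∀ {m} {f g : Fin m → ℚ} → (∀ i → f i ≡ g i) → sumFin m f ≡ sumFin m g
sumFin-cong {zero}  f≡g = refl
sumFin-cong {suc m} f≡g = cong₂ _+_ (f≡g zero) (sumFin-cong (f≡g ∘ suc))

sumFin-mono : ∀ {m} {f g : Fin m → ℚ} → (∀ i → f i ≤ g i) → sumFin m f ≤ sumFin m g
sumFin-mono {zero}  f≤g = ℚP.≤-refl
sumFin-mono {suc m} f≤g = ℚP.+-mono-≤ (f≤g zero) (sumFin-mono (f≤g ∘ suc))

module ℚSum = CommutativeMonoidSum ℚP.+-0-commutativeMonoid

sumFin≡sum : ∀ {m} (f : Fin m → ℚ) → sumFin m f ≡ ℚSum.sum f
sumFin≡sum {zero}  f = refl
sumFin≡sum {suc m} f = cong (f zero +_) (sumFin≡sum (f ∘ suc))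

sumFin-permute : ∀ {m} (σ : Permutation′ m) (f : Fin m → ℚ) →
                 sumFin m f ≡ sumFin m (f ∘ (σ ⟨$⟩ʳ_))
sumFin-permute σ f =
  trans (sumFin≡sum f) (trans (ℚSum.sum-permute f σ) (sym (sumFin≡sum (f ∘ (σ ⟨$⟩ʳ_)))))

sumOverᵇ : ∀ {m} → (Fin m → Bool) → (Fin m → ℚ) → ℚ
sumOverᵇ {m} b f = sumFin m (λ i → if b i then f i else 0ℚ)

sumOverᵇ-cong : ∀ {m} {b b′ : Fin m → Bool} {f g : Fin m → ℚ} →
                (∀ i → b i ≡ b′ i) → (∀ i → f i ≡ g i) → sumOverᵇ b f ≡ sumOverᵇ b′ g
sumOverᵇ-cong b≡b′ f≡g = sumFin-cong (λ i → cong₂ (if_then_else 0ℚ) (b≡b′ i) (f≡g i))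

does-∈?≡lookup : ∀ {m} (S : Subset m) i → ⌊ i ∈? S ⌋ ≡ lookup S i
does-∈?≡lookup (true ∷ S)  zero    = refl
does-∈?≡lookup (false ∷ S) zero    = refl
does-∈?≡lookup (_ ∷ S)     (suc i) with i ∈? S | does-∈?≡lookup S i
... | yes _ | eq = eq
... | no _  | eq = eq

sumOver≡sumOverᵇ : ∀ {m} (S : Subset m) f → sumOver S f ≡ sumOverᵇ (lookup S) f
sumOver≡sumOverᵇ S f = sumFin-cong (λ i → cong (if_then f i else 0ℚ) (does-∈?≡lookup S i))

sumOverᵇ-permute-≤ : ∀ {m} (σ : Permutation′ m) (b : Fin m → Bool) {f g : Fin m → ℚ} →
                     (∀ i → b i ≡ true → f (σ ⟨$⟩ʳ i) ≤ g i) →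
                     sumOverᵇ (b ∘ (σ ⟨$⟩ˡ_)) f ≤ sumOverᵇ b g
sumOverᵇ-permute-≤ {m} σ b {f} {g} f∘σ≤g = begin
  sumOverᵇ (b ∘ (σ ⟨$⟩ˡ_)) f
    ≡⟨ sumFin-permute σ _ ⟩
  sumFin m (λ i → if b (σ ⟨$⟩ˡ (σ ⟨$⟩ʳ i)) then f (σ ⟨$⟩ʳ i) else 0ℚ)
    ≡⟨ sumFin-cong (λ i → cong (if_then f (σ ⟨$⟩ʳ i) else 0ℚ) (cong b (inverseˡ σ))) ⟩
  sumOverᵇ b (f ∘ (σ ⟨$⟩ʳ_))
    ≤⟨ sumFin-mono pointwise ⟩
  sumOverᵇ b g ∎
  where
    open ℚP.≤-Reasoning
    pointwise : ∀ i → (if b i then f (σ ⟨$⟩ʳ i) else 0ℚ) ≤ (if b i then g i else 0ℚ)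
    pointwise i with b i in bi
    ... | true  = f∘σ≤g i bi
    ... | false = ℚP.≤-refl

offDiagonal : ∀ {m} → CostMatrix m → Fin m → Fin m → ℚ
offDiagonal Q e f = if ⌊ e Fin.≟ f ⌋ then 0ℚ else Q e f

costᵇ : ∀ {m} → CostMatrix m → (Fin m → Bool) → ℚ
costᵇ Q b = sumOverᵇ b (λ e → sumOverᵇ b (offDiagonal Q e)) + sumOverᵇ b (λ e → Q e e)

qmstCost≡costᵇ : ∀ {m} (Q : CostMatrix m) (S : Subset m) → qmstCost Q S ≡ costᵇ Q (lookup S)
qmstCost≡costᵇ Q S = cong₂ _+_
  (trans (sumOver≡sumOverᵇ S _)
         (sumOverᵇ-cong (λ _ → refl) (λ e → sumOver≡sumOverᵇ S (offDiagonal Q e))))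
  (sumOver≡sumOverᵇ S _)

costᵇ-cong : ∀ {m} (Q : CostMatrix m) {b b′ : Fin m → Bool} → (∀ i → b i ≡ b′ i) →
             costᵇ Q b ≡ costᵇ Q b′
costᵇ-cong Q b≡b′ = cong₂ _+_
  (sumOverᵇ-cong b≡b′ (λ i → sumOverᵇ-cong b≡b′ (λ _ → refl)))
  (sumOverᵇ-cong b≡b′ (λ _ → refl))

module Graded {m} (Q : CostMatrix m) (π : Permutation′ m)
              (graded : DoublyGraded (permute π Q)) where

  graded-mono : ∀ {a a′ c c′} → π ⟨$⟩ʳ a Fin.≤ π ⟨$⟩ʳ a′ → π ⟨$⟩ʳ c Fin.≤ π ⟨$⟩ʳ c′ →
                Q a c ≤ Q a′ c′
  graded-mono {a} {a′} {c} {c′} a≤a′ c≤c′ =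
    subst₂ _≤_ (cong₂ Q (inverseˡ π) (inverseˡ π)) (cong₂ Q (inverseˡ π) (inverseˡ π))
      (ℚP.≤-trans (proj₁ graded (π ⟨$⟩ʳ a) (π ⟨$⟩ʳ c) (π ⟨$⟩ʳ c′) c≤c′)
                  (proj₂ graded (π ⟨$⟩ʳ c′) (π ⟨$⟩ʳ a) (π ⟨$⟩ʳ a′) a≤a′))

  costᵇ-exchange-≤ : ∀ {b inn out} → π ⟨$⟩ʳ inn Fin.≤ π ⟨$⟩ʳ out → b inn ≡ false →
                     costᵇ Q (b ∘ PC.transpose inn out) ≤ costᵇ Q b
  costᵇ-exchange-≤ {b} {inn} {out} inn≤out b-inn =
    ℚP.+-mono-≤
      (sumOverᵇ-permute-≤ σ b λ _ bi →
        sumOverᵇ-permute-≤ σ b λ _ bj → offDiagonal-≤ (lowers bi) (lowers bj))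
      (sumOverᵇ-permute-≤ σ b λ _ bi → graded-mono (lowers bi) (lowers bi))
    where
      -- σ ⟨$⟩ˡ_ is PC.transpose inn out, so the exchanged edge set is b ∘ σ⁻¹.
      σ : Permutation′ m
      σ = Perm.transpose out inn

      lowers : ∀ {i} → b i ≡ true → π ⟨$⟩ʳ (σ ⟨$⟩ʳ i) Fin.≤ π ⟨$⟩ʳ i
      lowers {i} bi with transpose-cases out inn i
      ... | inj₁ (refl , σi≡inn) rewrite σi≡inn = inn≤out
      ... | inj₂ (inj₁ (_ , refl , _)) = contradiction (trans (sym bi) b-inn) λ ()
      ... | inj₂ (inj₂ (_ , _ , σi≡i)) rewrite σi≡i = ≤ᶠ-refl

      offDiagonal-≤ : ∀ {i j} → π ⟨$⟩ʳ (σ ⟨$⟩ʳ i) Fin.≤ π ⟨$⟩ʳ i →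
                      π ⟨$⟩ʳ (σ ⟨$⟩ʳ j) Fin.≤ π ⟨$⟩ʳ j →
                      offDiagonal Q (σ ⟨$⟩ʳ i) (σ ⟨$⟩ʳ j) ≤ offDiagonal Q i j
      offDiagonal-≤ {i} {j} i-lowers j-lowers with i Fin.≟ j | (σ ⟨$⟩ʳ i) Fin.≟ (σ ⟨$⟩ʳ j)
      ... | yes _    | yes _    = ℚP.≤-refl
      ... | yes refl | no σi≢σi = contradiction refl σi≢σi
      ... | no i≢j   | yes σi≡σj = contradiction (Injection.injective (↔⇒↣ σ) σi≡σj) i≢j
      ... | no _     | no _     = graded-mono i-lowers j-lowers

sumℕ : ∀ m → (Fin m → ℕ) → ℕ
sumℕ zero    f = 0
sumℕ (suc m) f = f zero ℕ.+ sumℕ m (f ∘ suc)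

sumℕ-mono : ∀ {m} {f g : Fin m → ℕ} → (∀ i → f i ℕ.≤ g i) → sumℕ m f ℕ.≤ sumℕ m g
sumℕ-mono {zero}  f≤g = ℕ.z≤n
sumℕ-mono {suc m} f≤g = ℕP.+-mono-≤ (f≤g zero) (sumℕ-mono (f≤g ∘ suc))

sumℕ-mono-< : ∀ {m} {f g : Fin m → ℕ} → (∀ i → f i ℕ.≤ g i) → ∀ k → f k ℕ.< g k →
              sumℕ m f ℕ.< sumℕ m g
sumℕ-mono-< {suc m} f≤g zero    fk<gk = ℕP.+-mono-<-≤ fk<gk (sumℕ-mono (f≤g ∘ suc))
sumℕ-mono-< {suc m} f≤g (suc k) fk<gk = ℕP.+-mono-≤-< (f≤g zero) (sumℕ-mono-< (f≤g ∘ suc) k fk<gk)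

-- Splitting on the second argument first makes fresh x true reduce to 0.
fresh : Bool → Bool → ℕ
fresh _     true  = 0
fresh true  false = 1
fresh false false = 0

edgesOutside : ∀ {m} → (Fin m → Bool) → (Fin m → Bool) → ℕ
edgesOutside {m} b t = sumℕ m (λ i → fresh (b i) (t i))

edgesOutside-exchange-< : ∀ {m} (b t : Fin m → Bool) {inn out} → inn ≢ out →
                          t inn ≡ true → t out ≡ false → b inn ≡ false → b out ≡ true →
                          edgesOutside (b ∘ PC.transpose inn out) t ℕ.< edgesOutside b t
edgesOutside-exchange-< b t {inn} {out} inn≢out t-inn t-out b-inn b-out =
  sumℕ-mono-< pointwise out at-out
  where
    pointwise : ∀ k → fresh (b (PC.transpose inn out k)) (t k) ℕ.≤ fresh (b k) (t k)
    pointwise k with transpose-cases inn out k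
    ... | inj₁ (refl , _)                    rewrite t-inn                   = ℕ.z≤n
    ... | inj₂ (inj₁ (_ , refl , σk≡inn))    rewrite σk≡inn | b-inn | t-out = ℕ.z≤n
    ... | inj₂ (inj₂ (_ , _ , σk≡k))         rewrite σk≡k                    = ℕP.≤-refl

    at-out : fresh (b (PC.transpose inn out out)) (t out) ℕ.< fresh (b out) (t out)
    at-out with transpose-cases inn out out
    ... | inj₁ (out≡inn , _)            = contradiction (sym out≡inn) inn≢out
    ... | inj₂ (inj₁ (_ , _ , σout≡inn)) rewrite σout≡inn | b-inn | b-out | t-out = ℕP.≤-refl
    ... | inj₂ (inj₂ (_ , out≢out , _)) = contradiction refl out≢out

filterᵇ-head : ∀ {A : Set} (P : A → Bool) {xs y} → y ∈ˡ xs → P y ≡ true →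
               ∃[ z ] ∃[ zs ] filterᵇ P xs ≡ z ∷ zs × z ∈ˡ xs
filterᵇ-head P {x ∷ xs} y∈ Py with P x in Px
... | true = x , filterᵇ P xs , refl , here refl
filterᵇ-head P {x ∷ xs} (here refl)  Py | false = contradiction (trans (sym Py) Px) λ ()
filterᵇ-head P {x ∷ xs} (there y∈xs) Py | false with filterᵇ-head P y∈xs Py
... | z , zs , eq , z∈xs = z , zs , eq , there z∈xs

module _ {m} (P P′ : Fin m → Bool) {j y : Fin m} (Pj : P j ≡ false) (P′j : P′ j ≡ true)
         (agree : ∀ {x} → x Fin.< j → P x ≡ P′ x) (j<y : j Fin.< y) (Py : P y ≡ true) where

  ¬LexLeq-filterᵇ : ∀ {xs} → AllPairs Fin._<_ xs → j ∈ˡ xs → y ∈ˡ xs →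
                    ¬ LexLeq (map toℕ (filterᵇ P xs)) (map toℕ (filterᵇ P′ xs))
  ¬LexLeq-filterᵇ {x ∷ xs} (x<xs ∷ _) (here refl) y∈ le rewrite Pj | P′j with y∈
  ... | here refl = ℕP.<-irrefl refl j<y
  ... | there y∈xs with filterᵇ-head P y∈xs Py
  ...   | z , zs , eq , z∈xs rewrite eq with le
  ...     | inj₁ z<j       = ℕP.<-asym z<j (All.lookup x<xs z∈xs)
  ...     | inj₂ (z≡j , _) = ℕP.<-irrefl (sym z≡j) (All.lookup x<xs z∈xs)
  ¬LexLeq-filterᵇ {x ∷ xs} (x<xs ∷ _) (there j∈xs) (here refl) _ =
    ℕP.<-asym j<y (All.lookup x<xs j∈xs)
  ¬LexLeq-filterᵇ {x ∷ xs} (x<xs ∷ sorted) (there j∈xs) (there y∈xs) le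
    with P x | P′ x | agree (All.lookup x<xs j∈xs)
  ... | false | false | _ = ¬LexLeq-filterᵇ sorted j∈xs y∈xs le
  ... | true  | true  | _ with le
  ...   | inj₁ x<x       = ℕP.<-irrefl refl x<x
  ...   | inj₂ (_ , le′) = ¬LexLeq-filterᵇ sorted j∈xs y∈xs le′

exchanged : ∀ {m} → Subset m → Fin m → Fin m → Subset m
exchanged S inn out = tabulate (lookup S ∘ PC.transpose inn out)

lookup-exchanged : ∀ {m} (S : Subset m) inn out i →
                   lookup (exchanged S inn out) i ≡ lookup S (PC.transpose inn out i)
lookup-exchanged S inn out = lookup∘tabulate (lookup S ∘ PC.transpose inn out)

sortedImage-exchange : ∀ {m} (π : Permutation′ m) (S : Subset m) {inn out} →
                       lookup S inn ≡ false → lookup S out ≡ true → π ⟨$⟩ʳ inn Fin.< π ⟨$⟩ʳ out →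
                       ¬ LexLeq (sortedImage π S) (sortedImage π (exchanged S inn out))
sortedImage-exchange {m} π S {inn} {out} S-inn S-out inn<out =
  ¬LexLeq-filterᵇ (image S) (image S′) S∌inn S′∋inn agree inn<out S∋out
    (tabulate⁺-< id) (∈-allFin _) (∈-allFin _)
  where
    S′ = exchanged S inn out

    image : Subset m → Fin m → Bool
    image S x = ⌊ (π ⟨$⟩ˡ x) ∈? S ⌋

    image-rank : ∀ S {x} → image S (π ⟨$⟩ʳ x) ≡ lookup S x
    image-rank S = trans (does-∈?≡lookup S _) (cong (lookup S) (inverseˡ π))

    S∌inn : image S (π ⟨$⟩ʳ inn) ≡ false
    S∌inn = trans (image-rank S) S-inn

    S∋out : image S (π ⟨$⟩ʳ out) ≡ true
    S∋out = trans (image-rank S) S-out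

    S′∋inn : image S′ (π ⟨$⟩ʳ inn) ≡ true
    S′∋inn = begin
      image S′ (π ⟨$⟩ʳ inn)                 ≡⟨ image-rank S′ ⟩
      lookup S′ inn                         ≡⟨ lookup-exchanged S inn out inn ⟩
      lookup S (PC.transpose inn out inn)   ≡⟨ cong (lookup S) (transpose-matchˡ inn out) ⟩
      lookup S out                          ≡⟨ S-out ⟩
      true                                  ∎
      where open ≡-Reasoning

    ranked : ∀ {x g} → π ⟨$⟩ˡ x ≡ g → toℕ x ≡ toℕ (π ⟨$⟩ʳ g)
    ranked x≡g = cong toℕ (trans (sym (inverseʳ π)) (cong (π ⟨$⟩ʳ_) x≡g))

    agree : ∀ {x} → x Fin.< π ⟨$⟩ʳ inn → image S x ≡ image S′ x
    agree {x} x<inn with transpose-cases inn out (π ⟨$⟩ˡ x)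
    ... | inj₁ (x≡inn , _)           = contradiction x<inn (ℕP.<-irrefl (ranked x≡inn))
    ... | inj₂ (inj₁ (_ , x≡out , _)) =
      contradiction (ℕP.<-trans x<inn inn<out) (ℕP.<-irrefl (ranked x≡out))
    ... | inj₂ (inj₂ (_ , _ , σx≡x)) = begin
      image S x                                      ≡⟨ does-∈?≡lookup S _ ⟩
      lookup S (π ⟨$⟩ˡ x)                            ≡⟨ cong (lookup S) σx≡x ⟨
      lookup S (PC.transpose inn out (π ⟨$⟩ˡ x))     ≡⟨ lookup-exchanged S inn out _ ⟨
      lookup S′ (π ⟨$⟩ˡ x)                           ≡⟨ does-∈?≡lookup S′ _ ⟨
      image S′ x                                     ∎
      where open ≡-Reasoning

module Optimality {n m} (G : Graph n m) {Q : CostMatrix m} (π : Permutation′ m)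
                  (graded : DoublyGraded (permute π Q)) {T : EdgeSet m} (critical : Critical G π T)
                  where
  open Trees G
  open Graded Q π graded

  tree-T : IsTree (Edges (lookup T))
  tree-T = SpanningTree⇒IsTree (proj₁ critical)

  Below : Fin m → Fin m → Set
  Below f g = lookup T g ≡ true × π ⟨$⟩ʳ g Fin.< π ⟨$⟩ʳ f

  cycle-property : ∀ {f} → lookup T f ≡ false → ¬ ¬ Walk G (Below f) (end₁ f) (end₂ f)
  cycle-property {f} T-f ¬w = cut-edge (proj₂ tree-T) (proj₁ tree-T _ _) ¬w
    λ (e , T-e , ¬below , ¬w∖e) →
      sortedImage-exchange π T T-f T-e (f<e T-e ¬below)
        (proj₂ critical _ (IsTree⇒SpanningTree (IsTree-resp
          (λ T′∋ → trans (lookup-exchanged T f e _) T′∋)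
          (λ T′∋ → trans (sym (lookup-exchanged T f e _)) T′∋)
          (exchangeᵇ tree-T T-e T-f ¬w∖e))))
    where
      π-injective : ∀ {a b} → toℕ (π ⟨$⟩ʳ b) ≡ toℕ (π ⟨$⟩ʳ a) → a ≡ b
      π-injective πb≡πa = sym (Injection.injective (↔⇒↣ π) (toℕ-injective πb≡πa))

      f<e : ∀ {e} → lookup T e ≡ true → ¬ Below f e → π ⟨$⟩ʳ f Fin.< π ⟨$⟩ʳ e
      f<e T-e ¬below = ℕP.≤∧≢⇒< (ℕP.≮⇒≥ (λ e<f → ¬below (T-e , e<f))) λ πf≡πe →
        contradiction (trans (sym T-e) (trans (cong (lookup T) (π-injective πf≡πe)) T-f)) λ ()

  ¬¬cost-≤ : ∀ k b → edgesOutside b (lookup T) ℕ.< k → IsTree (Edges b) →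
             ¬ ¬ (costᵇ Q (lookup T) ≤ costᵇ Q b)
  ¬¬cost-≤ (suc k) b outside<k tree-b = do
    yes (f , b-f , T-f) ← ¬¬-excluded-middle {A = ∃[ f ] b f ≡ true × lookup T f ≡ false}
      where no b⊆T → pure (ℚP.≤-reflexive (costᵇ-cong Q (λ i → sym (b≡T b⊆T i))))
    below ← cycle-property T-f
    (e , x , y , (T-e , e<f) , x—y , ↝x , ¬↝y) ←
      crossing-edge (Walk G (Edges b ∖ f) (end₁ f)) below here (proj₂ tree-b f b-f)
    let e≢f : e ≢ f
        e≢f = λ { refl → ℕP.<-irrefl refl e<f }
        b-e : b e ≡ false
        b-e = BoolP.¬-not λ b-e → ¬↝y (↝x ++ʷ step e (b-e , e≢f) x—y here)
        ¬w : ¬ Walk G (Edges b ∖ f) (end₁ e) (end₂ e)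
        ¬w = λ w → ¬↝y (↝x ++ʷ joins-walk x—y w)
        fewer : edgesOutside (b ∘ PC.transpose e f) (lookup T) ℕ.< k
        fewer = ℕP.<-≤-trans (edgesOutside-exchange-< b (lookup T) e≢f T-e T-f b-e b-f)
                             (ℕP.≤-pred outside<k)
    T≤b′ ← ¬¬cost-≤ k (b ∘ PC.transpose e f) fewer (exchangeᵇ tree-b b-f b-e ¬w)
    pure (ℚP.≤-trans T≤b′ (costᵇ-exchange-≤ (ℕP.<⇒≤ e<f) b-e))
    where
      b≡T : ¬ (∃[ f ] b f ≡ true × lookup T f ≡ false) → ∀ i → b i ≡ lookup T i
      b≡T no-f i = BoolP.⇔→≡ (mk⇔ b⊆T T⊆b)
        where
          b⊆T : ∀ {g} → b g ≡ true → lookup T g ≡ true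
          b⊆T {g} b-g = decidable-stable (lookup T g BoolP.≟ true)
            λ T-g → no-f (g , b-g , BoolP.¬-not T-g)
          T⊆b : lookup T i ≡ true → b i ≡ true
          T⊆b T-i = decidable-stable (b i BoolP.≟ true)
            (connected⊆acyclic⇒¬¬⊇ (proj₁ tree-b) (proj₂ tree-T) b⊆T T-i)

  optimal : ∀ {T′} → SpanningTree G T′ → qmstCost Q T ≤ qmstCost Q T′
  optimal {T′} tree-T′ = decidable-stable (qmstCost Q T ℚP.≤? qmstCost Q T′)
    (subst₂ _≤_ (sym (qmstCost≡costᵇ Q T)) (sym (qmstCost≡costᵇ Q T′))
      <$> ¬¬cost-≤ _ (lookup T′) (ℕP.n<1+n _) (SpanningTree⇒IsTree tree-T′))

theorem10 : ∀ {n m : ℕ} (G : Graph n m) (Q : CostMatrix m) (π : Permutation′ m) →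
    DoublyGraded (permute π Q) →
    ∀ (T : EdgeSet m) → Critical G π T → Optimal G Q T
theorem10 G Q π graded T critical = proj₁ critical , λ _ → Optimality.optimal G π graded critical
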